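{- Let $G$ be a finitely separable graph, and let $A,B\subseteq V(G)$ be disjoint, finite sets of vertices each of which induces a connected subgraph of $G$. Then $G$ has a finite bond separating $A$ from $B$.
   Context: Two vertices of a graph $G$ are finitely separable if some finite set of edges separates them in $G$; $G$ is finitely separable if every pair of distinct vertices is finitely separable. A cut of $G$ is a set of edges $E(V_1,V_2)$ between the two classes of a bipartition $(V_1,V_2)$ of $V(G)$; a bond is a minimal nonempty cut. A cut separates $A$ from $B$ if $A\subseteq V_1$ and $B\subseteq V_2$ (or vice versa). Graphs may be infinite. -}

module Defs where

open import Level using (0ℓ)
open import Data.Bool using (Bool; true; false)
open import Data.Product using (Σ; ∃; _×_; _,_)
open import Data.Sum using (_⊎_)
open import Data.Empty using (⊥)
open import Data.List using (List)
open import Data.List.Membership.Propositional using (_∈_)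
open import Relation.Nullary using (¬_)
open import Relation.Binary.PropositionalEquality using (_≡_; _≢_)

record Graph : Set₁ where
  field
    V      : Set
    Adj    : V → V → Set
    Adj-sym    : ∀ {u v} → Adj u v → Adj v u
    Adj-irrefl : ∀ {v} → ¬ Adj v v

module _ (G : Graph) where
  open Graph G

  -- A finite set of edges, given by a list of endpoint pairs;
  -- the edge {u,v} belongs to it if (u,v) or (v,u) is listed.
  EdgeList : Set
  EdgeList = List (V × V)

  _∈E_ : (V × V) → EdgeList → Set
  (u , v) ∈E L = ((u , v) ∈ L) ⊎ ((v , u) ∈ L)

  data WalkAvoiding (F : V → V → Set) : V → V → Set where
    here : ∀ {v} → WalkAvoiding F v v
    step : ∀ {u w v} → Adj u w → ¬ F u w → WalkAvoiding F w v → WalkAvoiding F u v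

  -- Walks in G all of whose vertices after the first satisfy P
  -- (used with a starting vertex in P: walks in the induced subgraph G[P]).
  data WalkIn (P : V → Set) : V → V → Set where
    here : ∀ {v} → WalkIn P v v
    step : ∀ {u w v} → Adj u w → P w → WalkIn P w v → WalkIn P u v

  NoEdges : V → V → Set
  NoEdges _ _ = ⊥

  Connected : Set
  Connected = ∀ u v → WalkAvoiding NoEdges u v

  SeparatedBy : EdgeList → V → V → Set
  SeparatedBy L x y = ¬ WalkAvoiding (λ u w → (u , w) ∈E L) x y

  FinitelySeparable : Set
  FinitelySeparable = ∀ x y → x ≢ y → ∃ λ (L : EdgeList) → SeparatedBy L x y

  InducesConnected : List V → Set
  InducesConnected A =
    (∃ λ a → a ∈ A) × (∀ a b → a ∈ A → b ∈ A → WalkIn (λ x → x ∈ A) a b)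

  Disjoint : List V → List V → Set
  Disjoint A B = ∀ v → v ∈ A → v ∈ B → ⊥

  -- A bipartition (V₁,V₂) of V(G) is given by side : V → Bool,
  -- V₁ = side⁻¹(true), V₂ = side⁻¹(false).  Its cut E(V₁,V₂):
  CutEdge : (V → Bool) → V → V → Set
  CutEdge side u v = Adj u v × side u ≢ side v

  NonemptyCut : (V → Bool) → Set
  NonemptyCut side = ∃ λ u → ∃ λ v → CutEdge side u v

  -- a bond: a minimal nonempty cut (every nonempty cut contained in it equals it)
  IsBond : (V → Bool) → Set
  IsBond side =
    NonemptyCut side ×
    (∀ side' → NonemptyCut side' →
       (∀ u v → CutEdge side' u v → CutEdge side u v) →
       (∀ u v → CutEdge side u v → CutEdge side' u v))

  FiniteCut : (V → Bool) → Set
  FiniteCut side = ∃ λ (L : EdgeList) →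
    ∀ u v → (CutEdge side u v → (u , v) ∈E L) × ((u , v) ∈E L → CutEdge side u v)

  SeparatesSets : (V → Bool) → List V → List V → Set
  SeparatesSets side A B =
    ((∀ a → a ∈ A → side a ≡ true)  × (∀ b → b ∈ B → side b ≡ false)) ⊎
    ((∀ a → a ∈ A → side a ≡ false) × (∀ b → b ∈ B → side b ≡ true))

-- Let L be a finite set of edges separating every a ∈ A from every b ∈ B
-- (a union of finitely many finite separators).  Let C be the set of
-- vertices reachable from A in G − L, and D the component of G − C that
-- contains B.  Every edge leaving D ends in C, and such an edge lies in L
-- since otherwise its end in D would be reachable from A; so E(D, V ∖ D)
-- is a finite cut separating A from B.  Both D and V ∖ D are connected:
-- D by construction, and V ∖ D because a walk from any of its vertices to
-- A stays outside D until it first meets the connected set C.  A cut of a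
-- connected graph whose two sides induce connected subgraphs is a bond.
module Submission where

open import Defs
open import Level using (0ℓ)
open import Axiom.ExcludedMiddle using (ExcludedMiddle)
open import Function using (_∘_)
open import Data.Bool using (Bool; true; false)
open import Data.Bool.Properties using () renaming (_≟_ to _≟ᴮ_)
open import Data.Product using (∃; _×_; _,_; proj₁; proj₂; uncurry)
open import Data.Sum using (_⊎_; inj₁; inj₂; swap)
open import Data.Empty using (⊥-elim)
open import Data.List using (List; []; _∷_; _++_; filter)
open import Data.List.Relation.Unary.Any using (here; there)
open import Data.List.Membership.Propositional using (_∈_)
open import Data.List.Membership.Propositional.Properties using (∈-filter⁺; ∈-filter⁻)
open import Data.List.Relation.Binary.Subset.Propositional using (_⊆_)
open import Data.List.Relation.Binary.Subset.Propositional.Properties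
  using (xs⊆xs++ys; xs⊆ys++xs)
open import Relation.Nullary using (¬_; yes; no; does)
open import Relation.Unary using (Decidable)
open import Relation.Nullary.Decidable using (dec-true; dec-false)
open import Relation.Binary.PropositionalEquality using (_≡_; _≢_; refl; sym; trans)

∀∈∃⇒∃∀∈ : ∀ {a b ℓ} {X : Set a} {E : Set b} (Q : X → List E → Set ℓ) →
  (∀ {x L L′} → L ⊆ L′ → Q x L → Q x L′) →
  (xs : List X) → (∀ x → x ∈ xs → ∃ (Q x)) → ∃ λ L → ∀ x → x ∈ xs → Q x L
∀∈∃⇒∃∀∈ Q mono [] witness = [] , λ _ ()
∀∈∃⇒∃∀∈ Q mono (x ∷ xs) witness with witness x (here refl)
                                    | ∀∈∃⇒∃∀∈ Q mono xs (λ y → witness y ∘ there)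
... | L , qx | L′ , qxs = L ++ L′ , λ
  { y (here refl) → mono (xs⊆xs++ys L L′) qx
  ; y (there y∈) → mono (xs⊆ys++xs L′ L) (qxs y y∈) }

≢⇒covers : {x y : Bool} → x ≢ y → ∀ z → z ≡ x ⊎ z ≡ y
≢⇒covers {false} {false} x≢y _ = ⊥-elim (x≢y refl)
≢⇒covers {true}  {true}  x≢y _ = ⊥-elim (x≢y refl)
≢⇒covers {false} {true}  _ false = inj₁ refl
≢⇒covers {false} {true}  _ true  = inj₂ refl
≢⇒covers {true}  {false} _ false = inj₂ refl
≢⇒covers {true}  {false} _ true  = inj₁ refl

module _ (lem : ExcludedMiddle 0ℓ) {X : Set} where

  indicator : (X → Set) → X → Bool
  indicator P x = does (lem {P x})

  indicator-≡ : ∀ {P x y} → indicator P x ≡ indicator P y → P x → P y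
  indicator-≡ {P} {x} {y} eq px with lem {P y}
  ... | yes py = py
  ... | no ¬py with () ← trans (sym (dec-true lem px)) eq

  indicator-≢ : ∀ {P x y} → indicator P x ≢ indicator P y → (P x × ¬ P y) ⊎ (¬ P x × P y)
  indicator-≢ {P} {x} {y} neq with lem {P x} | lem {P y}
  ... | yes _  | yes _   = ⊥-elim (neq refl)
  ... | yes px | no ¬py = inj₁ (px , ¬py)
  ... | no ¬px | yes py = inj₂ (¬px , py)
  ... | no _   | no _    = ⊥-elim (neq refl)

module _ (G : Graph) where
  open Graph G

  module _ {P : V → Set} where

    snoc-in : ∀ {u v w} → WalkIn G P u v → Adj v w → P w → WalkIn G P u w
    snoc-in here a pw = step a pw here
    snoc-in (step a px r) a′ pw = step a px (snoc-in r a′ pw)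

    _++-in_ : ∀ {u v w} → WalkIn G P u v → WalkIn G P v w → WalkIn G P u w
    here ++-in r′ = r′
    step a px r ++-in r′ = step a px (r ++-in r′)

    reverse-in : ∀ {u v} → P u → WalkIn G P u v → WalkIn G P v u
    reverse-in pu here = here
    reverse-in pu (step a px r) = snoc-in (reverse-in px r) (Adj-sym a) pu

    walkIn-last : ∀ {u v} → P u → WalkIn G P u v → P v
    walkIn-last pu here = pu
    walkIn-last pu (step a px r) = walkIn-last px r

  map-in : ∀ {P Q : V → Set} → (∀ {x} → P x → Q x) → ∀ {u v} → WalkIn G P u v → WalkIn G Q u v
  map-in f here = here
  map-in f (step a px r) = step a (f px) (map-in f r)

  snoc-avoiding : ∀ {F u v w} → WalkAvoiding G F u v → Adj v w → ¬ F v w → WalkAvoiding G F u w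
  snoc-avoiding here a nf = step a nf here
  snoc-avoiding (step a nf′ r) a′ nf = step a nf′ (snoc-avoiding r a′ nf)

  avoiding-mono : ∀ {F F′ : V → V → Set} → (∀ {x y} → F′ x y → F x y) →
    ∀ {u v} → WalkAvoiding G F u v → WalkAvoiding G F′ u v
  avoiding-mono sub here = here
  avoiding-mono sub (step a nf r) = step a (nf ∘ sub) (avoiding-mono sub r)

  ReachableIn : (V → Set) → List V → V → Set
  ReachableIn P S v = ∃ λ s → s ∈ S × WalkIn G P s v

  ReachableAvoiding : (V → V → Set) → List V → V → Set
  ReachableAvoiding F S v = ∃ λ s → s ∈ S × WalkAvoiding G F s v

  walkIn-stays-reachable : ∀ {P S u v} → ReachableIn P S u →
    WalkIn G P u v → WalkIn G (ReachableIn P S) u v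
  walkIn-stays-reachable ru here = here
  walkIn-stays-reachable (s , s∈ , r) (step a px r′) =
    step a rx (walkIn-stays-reachable rx r′)
    where rx = s , s∈ , snoc-in r a px

  walkAvoiding-stays-reachable : ∀ {F S u v} → ReachableAvoiding F S u →
    WalkAvoiding G F u v → WalkIn G (ReachableAvoiding F S) u v
  walkAvoiding-stays-reachable ru here = here
  walkAvoiding-stays-reachable (s , s∈ , r) (step a nf r′) =
    step a rx (walkAvoiding-stays-reachable rx r′)
    where rx = s , s∈ , snoc-avoiding r a nf

  SeparatedBy-mono : ∀ {L L′ x y} → L ⊆ L′ → SeparatedBy G L x y → SeparatedBy G L′ x y
  SeparatedBy-mono L⊆L′ sep = sep ∘ avoiding-mono (Data.Sum.map L⊆L′ L⊆L′)

  separating-list : FinitelySeparable G → (A B : List V) → Disjoint G A B →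
    ∃ λ L → ∀ a → a ∈ A → ∀ b → b ∈ B → SeparatedBy G L a b
  separating-list fs A B disj =
    ∀∈∃⇒∃∀∈ (λ a L → ∀ b → b ∈ B → SeparatedBy G L a b)
      (λ L⊆L′ sep b b∈ → SeparatedBy-mono L⊆L′ (sep b b∈)) A
      λ a a∈ → ∀∈∃⇒∃∀∈ (λ b L → SeparatedBy G L a b) SeparatedBy-mono B
        λ b b∈ → fs a b λ { refl → disj a a∈ b∈ }

  CutEdge-sym : ∀ {side u v} → CutEdge G side u v → CutEdge G side v u
  CutEdge-sym (a , ne) = Adj-sym a , ne ∘ sym

  cut-in-list⇒finite : ExcludedMiddle 0ℓ → ∀ side (L : EdgeList G) →
    (∀ u v → CutEdge G side u v → _∈E_ G (u , v) L) → FiniteCut G side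
  cut-in-list⇒finite lem side L cut⊆L = filter cut? L , λ u v →
    (λ c → Data.Sum.map (λ m → ∈-filter⁺ cut? m c) (λ m → ∈-filter⁺ cut? m (CutEdge-sym c))
                        (cut⊆L u v c))
    , λ { (inj₁ m) → proj₂ (∈-filter⁻ cut? {xs = L} m)
        ; (inj₂ m) → CutEdge-sym (proj₂ (∈-filter⁻ cut? {xs = L} m)) }
    where
    cut? : Decidable (uncurry (CutEdge G side))
    cut? _ = lem

  crossing-edge : ∀ {F} side {u v} → WalkAvoiding G F u v → side u ≢ side v → NonemptyCut G side
  crossing-edge side here ne = ⊥-elim (ne refl)
  crossing-edge side {u} (step {w = w} a _ r) ne with side u ≟ᴮ side w
  ... | yes eq = crossing-edge side r (ne ∘ trans eq)
  ... | no neq = u , w , a , neq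

  RootedAt : (V → Bool) → V → Set
  RootedAt side r = ∀ v → side v ≡ side r → WalkIn G (λ x → side x ≡ side r) r v

  module _ (side side′ : V → Bool)
    (cut′⊆cut : ∀ u v → CutEdge G side′ u v → CutEdge G side u v) where

    uncut⇒uncut′ : ∀ {u v} → Adj u v → side u ≡ side v → side′ u ≡ side′ v
    uncut⇒uncut′ {u} {v} a eq with side′ u ≟ᴮ side′ v
    ... | yes eq′ = eq′
    ... | no neq′ = ⊥-elim (proj₂ (cut′⊆cut u v (a , neq′)) eq)

    side′-constant-on-class : ∀ {r u v} → side u ≡ side r →
      WalkIn G (λ x → side x ≡ side r) u v → side′ u ≡ side′ v
    side′-constant-on-class u~r here = refl
    side′-constant-on-class u~r (step a x~r walk) =
      trans (uncut⇒uncut′ a (trans u~r (sym x~r))) (side′-constant-on-class x~r walk)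

  rooted-classes⇒bond : Connected G → ∀ side p q → side p ≢ side q →
    RootedAt side p → RootedAt side q → IsBond G side
  rooted-classes⇒bond conn side p q p≁q rooted-p rooted-q =
    crossing-edge side (conn p q) p≁q , minimal
    where
    minimal : ∀ side′ → NonemptyCut G side′ →
      (∀ u v → CutEdge G side′ u v → CutEdge G side u v) →
      ∀ u v → CutEdge G side u v → CutEdge G side′ u v
    minimal side′ (x , y , _ , x≁′y) cut′⊆cut u v (a , u≁v) = a , u≁′v
      where
      on-class : ∀ {r} → RootedAt side r → ∀ {w} → side w ≡ side r → side′ w ≡ side′ r
      on-class rooted w~r =
        sym (side′-constant-on-class side side′ cut′⊆cut refl (rooted _ w~r))

      classes-merge : side′ u ≡ side′ v → side′ p ≡ side′ q
      classes-merge eq with ≢⇒covers p≁q (side u) | ≢⇒covers p≁q (side v)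
      ... | inj₁ u~p | inj₁ v~p = ⊥-elim (u≁v (trans u~p (sym v~p)))
      ... | inj₁ u~p | inj₂ v~q = trans (sym (on-class rooted-p u~p)) (trans eq (on-class rooted-q v~q))
      ... | inj₂ u~q | inj₁ v~p = trans (sym (on-class rooted-p v~p)) (trans (sym eq) (on-class rooted-q u~q))
      ... | inj₂ u~q | inj₂ v~q = ⊥-elim (u≁v (trans u~q (sym v~q)))

      side′-constant : side′ p ≡ side′ q → ∀ w → side′ w ≡ side′ p
      side′-constant p≈′q w with ≢⇒covers p≁q (side w)
      ... | inj₁ w~p = on-class rooted-p w~p
      ... | inj₂ w~q = trans (on-class rooted-q w~q) (sym p≈′q)

      u≁′v : side′ u ≢ side′ v
      u≁′v eq = x≁′y (trans (side′-constant p≈′q x) (sym (side′-constant p≈′q y)))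
        where p≈′q = classes-merge eq

  module Construction (lem : ExcludedMiddle 0ℓ) (conn : Connected G)
    (A B : List V) (icA : InducesConnected G A) (icB : InducesConnected G B)
    (L : EdgeList G) (sep : ∀ a → a ∈ A → ∀ b → b ∈ B → SeparatedBy G L a b) where

    C : V → Set
    C = ReachableAvoiding (λ u w → _∈E_ G (u , w) L) A

    D : V → Set
    D = ReachableIn (¬_ ∘ C) B

    side : V → Bool
    side = indicator lem D

    A⊆C : ∀ {a} → a ∈ A → C a
    A⊆C a∈ = _ , a∈ , here

    B⊆D : ∀ {b} → b ∈ B → D b
    B⊆D b∈ = _ , b∈ , here

    D⊆¬C : ∀ {v} → D v → ¬ C v
    D⊆¬C (b , b∈ , walk) = walkIn-last (λ { (a , a∈ , walk′) → sep a a∈ b b∈ walk′ }) walk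

    C⊆¬D : ∀ {v} → C v → ¬ D v
    C⊆¬D Cv Dv = D⊆¬C Dv Cv

    D-closed : ∀ {u v} → D u → Adj u v → ¬ C v → D v
    D-closed (b , b∈ , walk) a ¬Cv = b , b∈ , snoc-in walk a ¬Cv

    boundary-in-L : ∀ {u v} → D u → ¬ D v → Adj u v → _∈E_ G (u , v) L
    boundary-in-L {u} {v} Du ¬Dv a with lem {C v}
    ... | no ¬Cv = ⊥-elim (¬Dv (D-closed Du a ¬Cv))
    ... | yes (s , s∈ , walk) with lem {_∈E_ G (v , u) L}
    ...   | yes vu∈L = swap vu∈L
    ...   | no vu∉L = ⊥-elim (D⊆¬C Du (s , s∈ , snoc-avoiding walk (Adj-sym a) vu∉L))

    cut⊆L : ∀ u v → CutEdge G side u v → _∈E_ G (u , v) L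
    cut⊆L u v (a , u≁v) with indicator-≢ lem {P = D} u≁v
    ... | inj₁ (Du , ¬Dv) = boundary-in-L Du ¬Dv a
    ... | inj₂ (¬Du , Dv) = swap (boundary-in-L Dv ¬Du (Adj-sym a))

    b₀ : V
    b₀ = proj₁ (proj₁ icB)

    b₀∈B : b₀ ∈ B
    b₀∈B = proj₂ (proj₁ icB)

    a₀ : V
    a₀ = proj₁ (proj₁ icA)

    a₀∈A : a₀ ∈ A
    a₀∈A = proj₂ (proj₁ icA)

    rooted-b₀ : RootedAt side b₀
    rooted-b₀ v v~b₀ with indicator-≡ lem {P = D} (sym v~b₀) (B⊆D b₀∈B)
    ... | b , b∈ , b→v =
      map-in (λ Dx → trans (dec-true lem Dx) (sym (dec-true lem (B⊆D b₀∈B))))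
        (map-in B⊆D (proj₂ icB b₀ b b₀∈B b∈) ++-in walkIn-stays-reachable (B⊆D b∈) b→v)

    ¬D-spreads : ∀ {u v} → ¬ D u → ¬ C u → Adj u v → ¬ D v
    ¬D-spreads ¬Du ¬Cu a Dv = ¬Du (D-closed Dv (Adj-sym a) ¬Cu)

    escape-to-C : ∀ {v t} → ¬ D v → WalkAvoiding G (NoEdges G) v t → C t →
      ∃ λ c → C c × WalkIn G (¬_ ∘ D) v c
    escape-to-C {v} ¬Dv walk Ct with lem {C v}
    ... | yes Cv = v , Cv , here
    escape-to-C ¬Dv here Ct | no _ = _ , Ct , here
    escape-to-C ¬Dv (step a _ walk) Ct | no ¬Cv =
      let ¬Dx = ¬D-spreads ¬Dv ¬Cv a
          c , Cc , x→c = escape-to-C ¬Dx walk Ct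
      in c , Cc , step a ¬Dx x→c

    class-a₀⇒¬D : ∀ {v} → side v ≡ side a₀ → ¬ D v
    class-a₀⇒¬D v~a₀ Dv = C⊆¬D (A⊆C a₀∈A) (indicator-≡ lem {P = D} v~a₀ Dv)

    rooted-a₀ : RootedAt side a₀
    rooted-a₀ v v~a₀ with escape-to-C (class-a₀⇒¬D v~a₀) (conn v a₀) (A⊆C a₀∈A)
    ... | c , (a , a∈ , a→c) , v→c =
      map-in (λ ¬Dx → trans (dec-false lem ¬Dx) (sym (dec-false lem (C⊆¬D (A⊆C a₀∈A)))))
        (map-in C⊆¬D (map-in A⊆C (proj₂ icA a₀ a a₀∈A a∈) ++-in walkAvoiding-stays-reachable (A⊆C a∈) a→c)
         ++-in reverse-in (class-a₀⇒¬D v~a₀) v→c)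

    isBond : IsBond G side
    isBond = rooted-classes⇒bond conn side b₀ a₀ b₀≁a₀ rooted-b₀ rooted-a₀
      where
      b₀≁a₀ : side b₀ ≢ side a₀
      b₀≁a₀ eq = C⊆¬D (A⊆C a₀∈A) (indicator-≡ lem {P = D} eq (B⊆D b₀∈B))

    finiteCut : FiniteCut G side
    finiteCut = cut-in-list⇒finite lem side L cut⊆L

    separates : SeparatesSets G side A B
    separates = inj₂ ( (λ a a∈ → dec-false lem (C⊆¬D (A⊆C a∈)))
                     , (λ b b∈ → dec-true lem (B⊆D b∈)))

lemma2p3 : ExcludedMiddle 0ℓ → (G : Graph) → Connected G → FinitelySeparable G →
    (A B : List (Graph.V G)) → Disjoint G A B →
    InducesConnected G A → InducesConnected G B →
    ∃ λ (side : Graph.V G → Bool) →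
      IsBond G side × FiniteCut G side × SeparatesSets G side A B
lemma2p3 lem G conn fs A B disj icA icB with separating-list G fs A B disj
... | L , sep = side , isBond , finiteCut , separates
  where open Construction G lem conn A B icA icB L sep
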